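{- If $G$ and $H$ are graphs with $\mathrm{diam}(G)\geq3$ and $\mathrm{diam}(H)\geq3$, then $\gamma(G\diamond H)\leq3$.
   Context: All graphs are finite, simple and undirected; $\mathrm{diam}$ denotes the diameter (maximum distance, $\infty$ for disconnected graphs). The modular product $G\diamond H$ has vertex set $V(G)\times V(H)$, and two distinct vertices $(g,h)$ and $(g',h')$ are adjacent iff either ($g=g'$ and $hh'\in E(H)$), or ($gg'\in E(G)$ and $h=h'$), or ($gg'\in E(G)$ and $hh'\in E(H)$), or ($g\neq g'$, $h\neq h'$, $gg'\notin E(G)$ and $hh'\notin E(H)$). $\gamma$ is the domination number. -}

module Defs where

open import Data.Nat using (ℕ; zero; suc; _<_; _≤_)
open import Data.Fin using (Fin)
open import Data.Product using (_×_; _,_; ∃-syntax)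
open import Data.Sum using (_⊎_)
open import Data.List using (List; length)
open import Data.List.Membership.Propositional using (_∈_)
open import Relation.Nullary using (¬_)
open import Relation.Binary.PropositionalEquality using (_≡_; _≢_)

record Graph (n : ℕ) : Set₁ where
  field
    Adj    : Fin n → Fin n → Set
    sym    : ∀ {u v} → Adj u v → Adj v u
    irrefl : ∀ {u} → ¬ Adj u u
    adj?   : ∀ u v → Adj u v ⊎ ¬ Adj u v
open Graph public

module _ {V : Set} (Adj : V → V → Set) where

  data Walk : V → V → ℕ → Set where
    nil  : ∀ {u} → Walk u u zero
    cons : ∀ {u w v k} → Adj u w → Walk w v k → Walk u v (suc k)

  -- dist(u,v) ≥ d  (distance = length of a shortest walk, ∞ if none):
  -- there is no walk from u to v of length < d
  DistAtLeast : ℕ → V → V → Set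
  DistAtLeast d u v = ∀ k → k < d → ¬ Walk u v k

  DiamAtLeast : ℕ → Set
  DiamAtLeast d = ∃[ u ] ∃[ v ] DistAtLeast d u v

  Dominating : List V → Set
  Dominating D = ∀ v → v ∈ D ⊎ ∃[ u ] (u ∈ D × Adj u v)

  DomNumAtMost : ℕ → Set
  DomNumAtMost k = ∃[ D ] (length D ≤ k × Dominating D)

-- Adjacency of the modular product G ◇ H on Fin n × Fin m
ModAdj : ∀ {n m} → Graph n → Graph m → (Fin n × Fin m) → (Fin n × Fin m) → Set
ModAdj G H (g , h) (g' , h') =
    (g ≡ g' × Adj H h h')
  ⊎ (Adj G g g' × h ≡ h')
  ⊎ (Adj G g g' × Adj H h h')
  ⊎ (g ≢ g' × h ≢ h' × ¬ Adj G g g' × ¬ Adj H h h')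

{-# OPTIONS --safe #-}
module Submission where

-- Take u, v at distance ≥ 3 in G and x, y at distance ≥ 3 in H; then
-- {(u,x), (v,y), (u,y)} dominates G ◇ H. Write N[a] for the closed
-- neighbourhood of a (g ∈ N[a] is ReflClosure (Adj G) a g). In the modular
-- product, (a,b) dominates (g,h) both when g ∈ N[a] and h ∈ N[b], and when
-- g ∉ N[a] and h ∉ N[b]. If g ∈ N[u], then (u,y) dominates (g,h) when
-- h ∈ N[y]; otherwise (v,y) does, because g ∈ N[u] forces g ∉ N[v]. If
-- g ∉ N[u], then (u,x) dominates (g,h) when h ∉ N[x]; otherwise (u,y) does,
-- because h ∈ N[x] forces h ∉ N[y].

open import Level using (0ℓ)
open import Data.Nat using (z<s; s<s)
open import Data.Nat.Properties using (≤-refl)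
open import Data.Fin using (Fin)
open import Data.Fin.Properties using (_≟_)
open import Data.Product using (_×_; _,_; ∃-syntax)
open import Data.Sum using (_⊎_; inj₁; inj₂)
open import Data.List using (List; _∷_; [])
open import Data.List.Membership.Propositional using (_∈_)
open import Data.List.Relation.Unary.Any using (here; there)
open import Function using (_∘_)
open import Relation.Binary.Core using (Rel)
open import Relation.Binary.Definitions using (Decidable)
open import Relation.Binary.PropositionalEquality using (refl)
open import Relation.Binary.Construct.Closure.Reflexive as Refl using (ReflClosure; [_])
import Relation.Binary.Construct.Closure.Reflexive.Properties as Reflₚ
open import Relation.Nullary using (¬_; yes; no)
open import Relation.Nullary.Decidable using (fromSum)
open import Defs

module _ {V : Set} (R : Rel V 0ℓ) where

  distAtLeast3⇒¬closed∘closed : ∀ {u w v} → DistAtLeast R 3 u v →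
    ReflClosure R u w → ¬ ReflClosure R w v
  distAtLeast3⇒¬closed∘closed d Refl.refl Refl.refl = d 0 z<s nil
  distAtLeast3⇒¬closed∘closed d Refl.refl [ w∼v ]   = d 1 (s<s z<s) (cons w∼v nil)
  distAtLeast3⇒¬closed∘closed d [ u∼w ]   Refl.refl = d 1 (s<s z<s) (cons u∼w nil)
  distAtLeast3⇒¬closed∘closed d [ u∼w ]   [ w∼v ]   = d 2 (s<s (s<s z<s)) (cons u∼w (cons w∼v nil))

  closed-member⇒dominated : ∀ {D a v} → a ∈ D → ReflClosure R a v →
    v ∈ D ⊎ ∃[ u ] (u ∈ D × R u v)
  closed-member⇒dominated a∈D Refl.refl = inj₁ a∈D
  closed-member⇒dominated a∈D [ a∼v ]   = inj₂ (_ , a∈D , a∼v)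

module _ {n} (G : Graph n) where

  closed? : Decidable (ReflClosure (Adj G))
  closed? = Reflₚ.dec _≟_ (λ u v → fromSum (adj? G u v))

  distAtLeast3⇒disjoint-closed-neighbourhoods : ∀ {u v g} → DistAtLeast (Adj G) 3 u v →
    ReflClosure (Adj G) u g → ¬ ReflClosure (Adj G) v g
  distAtLeast3⇒disjoint-closed-neighbourhoods d ug vg =
    distAtLeast3⇒¬closed∘closed (Adj G) d ug (Reflₚ.sym (sym G) vg)

module ModularProduct {n m} (G : Graph n) (H : Graph m) where

  closed×closed⇒closed : ∀ {g g' h h'} →
    ReflClosure (Adj G) g g' → ReflClosure (Adj H) h h' →
    ReflClosure (ModAdj G H) (g , h) (g' , h')
  closed×closed⇒closed Refl.refl Refl.refl = Refl.refl
  closed×closed⇒closed Refl.refl [ hh' ]   = [ inj₁ (refl , hh') ]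
  closed×closed⇒closed [ gg' ]   Refl.refl = [ inj₂ (inj₁ (gg' , refl)) ]
  closed×closed⇒closed [ gg' ]   [ hh' ]   = [ inj₂ (inj₂ (inj₁ (gg' , hh'))) ]

  ¬closed×¬closed⇒adjacent : ∀ {g g' h h'} →
    ¬ ReflClosure (Adj G) g g' → ¬ ReflClosure (Adj H) h h' →
    ModAdj G H (g , h) (g' , h')
  ¬closed×¬closed⇒adjacent ¬gg' ¬hh' =
    inj₂ (inj₂ (inj₂ ( (λ { refl → ¬gg' Refl.refl })
                     , (λ { refl → ¬hh' Refl.refl })
                     , ¬gg' ∘ [_]
                     , ¬hh' ∘ [_] )))

proposition26 : ∀ {n m} (G : Graph n) (H : Graph m) →
    DiamAtLeast (Adj G) 3 → DiamAtLeast (Adj H) 3 →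
    DomNumAtMost (ModAdj G H) 3
proposition26 {n} {m} G H (u , v , duv) (x , y , dxy) = D , ≤-refl , dominating
  where
  open ModularProduct G H

  D : List (Fin n × Fin m)
  D = (u , x) ∷ (v , y) ∷ (u , y) ∷ []

  dominating : Dominating (ModAdj G H) D
  dominating (g , h) with closed? G u g
  ... | yes ug with closed? H y h
  ...   | yes yh = closed-member⇒dominated (ModAdj G H) (there (there (here refl)))
                     (closed×closed⇒closed ug yh)
  ...   | no ¬yh = closed-member⇒dominated (ModAdj G H) (there (here refl))
                     [ ¬closed×¬closed⇒adjacent
                         (distAtLeast3⇒disjoint-closed-neighbourhoods G duv ug) ¬yh ]
  dominating (g , h) | no ¬ug with closed? H x h
  ...   | yes xh = closed-member⇒dominated (ModAdj G H) (there (there (here refl)))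
                     [ ¬closed×¬closed⇒adjacent ¬ug
                         (distAtLeast3⇒disjoint-closed-neighbourhoods H dxy xh) ]
  ...   | no ¬xh = closed-member⇒dominated (ModAdj G H) (here refl)
                     [ ¬closed×¬closed⇒adjacent ¬ug ¬xh ]
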